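{- Let $n_1, n_2, n_3$ be three pairwise coprime positive integers which are the minimal generators of the numerical semigroup $\mathcal{S} = \langle n_1,n_2,n_3\rangle$. For $\{i,j,k\}=\{1,2,3\}$ let $c_k$ be the smallest positive integer $M$ such that $M n_k \in \langle n_i, n_j\rangle$. Then, for every $\{i,j,k\} = \{1,2,3\}$, $$c_k = \min_{\alpha = 1,\ldots,I_k} \left\{ \alpha n_j - [-n_i n_k^{ -1}]_{n_j} \left\lfloor \alpha \frac{n_k}{[n_i n_j^{ -1}]_{n_k}} \right\rfloor \right\},$$ where $$I_k = \left\lceil [-n_i n_k^{ -1}]_{n_j} \frac{[n_i n_j^{ -1}]_{n_k}}{n_i} \right\rceil.$$
   Context: $\langle a_1,\dots,a_r\rangle$ denotes the set of linear combinations of $a_1,\dots,a_r$ with nonnegative integer coefficients. "Minimal generators" means none of $n_1,n_2,n_3$ is such a combination of the other two. For integers $m$ and $n>0$, $[m]_n$ denotes the remainder of the Euclidean division of $m$ by $n$ (so $0\le [m]_n<n$); for $b$ coprime to $n$, $[a b^{ -1}]_n$ denotes the remainder modulo $n$ of $a$ times a multiplicative inverse of $b$ modulo $n$. -}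

module Defs where

open import Data.Nat using (ℕ; zero; suc; _+_; _*_; _∸_; _/_; _≤_; _<_)
open import Data.Nat.Coprimality using (Coprime)
open import Data.Integer as ℤ using (ℤ; +_)
import Data.Integer.Divisibility as ℤDiv
open import Data.Nat.Divisibility using (_∣_)
open import Data.Fin using (Fin)
open import Data.Product using (_×_; ∃₂)
open import Relation.Binary.PropositionalEquality using (_≡_; _≢_)
open import Relation.Nullary using (¬_)

_∈⟨_,_⟩ : ℕ → ℕ → ℕ → Set
m ∈⟨ a , b ⟩ = ∃₂ λ x y → x * a + y * b ≡ m

-- floor division; the divisor-0 case never occurs in the theorem
_div_ : ℕ → ℕ → ℕ
a div zero    = zero
a div (suc b) = a / suc b

-- ceiling division ⌈a / b⌉; the divisor-0 case never occurs in the theorem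
_cdiv_ : ℕ → ℕ → ℕ
a cdiv zero    = zero
a cdiv (suc b) = (a + b) / suc b

-- r = [ - a b⁻¹ ]_n : the residue r with 0 ≤ r < n and r·b ≡ -a (mod n)
IsNegQuotRes : ℕ → ℕ → ℕ → ℕ → Set
IsNegQuotRes a b n r = r < n × n ∣ (r * b + a)

-- s = [ a b⁻¹ ]_n : the residue s with 0 ≤ s < n and s·b ≡ a (mod n)
IsQuotRes : ℕ → ℕ → ℕ → ℕ → Set
IsQuotRes a b n s = s < n × (+ n) ℤDiv.∣ (+ (s * b) ℤ.- + a)

IsLeastPosMult : ℕ → ℕ → ℕ → ℕ → Set
IsLeastPosMult ni nj nk c =
  0 < c × (c * nk) ∈⟨ ni , nj ⟩ ×
  (∀ M → 0 < M → (M * nk) ∈⟨ ni , nj ⟩ → c ≤ M)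

term : ℕ → ℕ → ℕ → ℕ → ℕ → ℤ
term nj nk r s α = + (α * nj) ℤ.- + (r * ((α * nk) div s))

IsMinOver : ℕ → (ℕ → ℤ) → ℤ → Set
IsMinOver I f v =
  (∃₂ λ α (_ : 1 ≤ α × α ≤ I) → f α ≡ v) ×
  (∀ α → 1 ≤ α → α ≤ I → v ℤ.≤ f α)

PairwiseCoprime : (Fin 3 → ℕ) → Set
PairwiseCoprime n = ∀ i j → i ≢ j → Coprime (n i) (n j)

MinimalGenerators : (Fin 3 → ℕ) → Set
MinimalGenerators n =
  ∀ i j k → i ≢ j → j ≢ k → i ≢ k → ¬ (n k ∈⟨ n i , n j ⟩)

{-# OPTIONS --safe #-}
module Submission where

-- With a = nᵢ, b = nⱼ, d = nₖ, coprimality and minimality of the generators force the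
-- residues to satisfy s b = a + r d. For α ≥ 1 put q = ⌊α d / s⌋, ρ = α d mod s and
-- candidate α = α b − r q; then s · candidate α = α a + r ρ > 0 and
-- candidate α · d = q a + ρ b ∈ ⟨a, b⟩, so c ≤ candidate α.
-- Conversely, write c d = x a + y b. Then d (c + x r) = (x s + y) b, so α = (c + x r) / b
-- is an integer with α d = x s + y, whence x ≤ q and candidate α ≤ α b − r x = c. Finally
-- α a ≤ s c ≤ s · candidate 1 = a + r (d mod s) < a + r s bounds α by ⌈r s / a⌉.

open import Defs
open import Data.Nat using (ℕ; zero; suc; _+_; _*_; _∸_; _≤_; _<_; _/_; _%_; _≤?_; NonZero; >-nonZero; >-nonZero⁻¹; ≢-nonZero; z≤n; s≤s⁻¹)
open import Data.Nat.Properties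
open import Data.Nat.DivMod using (m≡m%n+[m/n]*n; m%n<n; m*n/n≡m; /-monoˡ-≤; /-congˡ)
open import Data.Nat.Divisibility using (_∣_; divides; ∣m+n∣m⇒∣n; n∣m*n; >⇒∤)
open import Data.Nat.Coprimality using (Coprime; coprime-divisor)
open import Data.Nat.Tactic.RingSolver using (solve)
open import Data.Integer using (+_)
import Data.Integer as ℤ
import Data.Integer.Properties as ℤ
import Data.Integer.Divisibility as ℤ
open import Data.Fin using (Fin)
open import Data.List using (_∷_; [])
open import Data.Product using (∃; ∃₂; _×_; _,_; proj₁; proj₂)
open import Data.Sum using (_⊎_; inj₁; inj₂)
open import Data.Empty using (⊥-elim)
open import Function using (_∘_)
open import Relation.Nullary using (¬_; yes; no)
open import Relation.Binary.PropositionalEquality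
  using (_≡_; _≢_; refl; sym; trans; cong; cong₂; subst; module ≡-Reasoning)

∣∧<⇒≡0 : ∀ {d m} → d ∣ m → m < d → m ≡ 0
∣∧<⇒≡0 {m = zero}  _   _   = refl
∣∧<⇒≡0 {m = suc _} d∣m m<d = ⊥-elim (>⇒∤ m<d d∣m)

ℤ∣[+m-+n]⇒≡+* : ∀ {d m n} → + d ℤ.∣ (+ m ℤ.- + n) →
  (∃ λ q → m ≡ n + q * d) ⊎ (∃ λ q → n ≡ m + q * d)
ℤ∣[+m-+n]⇒≡+* {d} {m} {n} d∣m-n rewrite ℤ.[+m]-[+n]≡m⊖n m n with n ≤? m
... | yes n≤m with divides q eq ← subst (λ i → d ∣ ℤ.∣ i ∣) (ℤ.⊖-≥ n≤m) d∣m-n =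
  inj₁ (q , trans (sym (m+[n∸m]≡n n≤m)) (cong (λ z → n + z) eq))
... | no n≰m with divides q eq ← subst (d ∣_) (ℤ.∣⊖∣-< (≰⇒> n≰m)) d∣m-n =
  inj₂ (q , trans (sym (m+[n∸m]≡n (<⇒≤ (≰⇒> n≰m)))) (cong (λ z → m + z) eq))

coprime-residue-≤⇒≡ : ∀ {a b d q r} → Coprime b d → q ≤ r → r < b →
  b ∣ q * d + a → b ∣ r * d + a → q ≡ r
coprime-residue-≤⇒≡ {a} {b} {d} {q} cop q≤r r<b b∣qd+a b∣rd+a
  with t , refl ← m≤n⇒∃[o]m+o≡n q≤r = sym (trans (cong (λ z → q + z) t≡0) (+-identityʳ q))
  where
  expand : (q + t) * d + a ≡ (q * d + a) + d * t
  expand = solve (q ∷ t ∷ d ∷ a ∷ [])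
  t≡0 : t ≡ 0
  t≡0 = ∣∧<⇒≡0 (coprime-divisor cop (∣m+n∣m⇒∣n (subst (b ∣_) expand b∣rd+a) b∣qd+a))
               (≤-<-trans (m≤n+m t q) r<b)

coprime-residue-unique : ∀ {a b d q r} → Coprime b d → q < b → r < b →
  b ∣ q * d + a → b ∣ r * d + a → q ≡ r
coprime-residue-unique {q = q} {r} cop q<b r<b b∣qd+a b∣rd+a with ≤-total q r
... | inj₁ q≤r = coprime-residue-≤⇒≡ cop q≤r r<b b∣qd+a b∣rd+a
... | inj₂ r≤q = sym (coprime-residue-≤⇒≡ cop r≤q q<b b∣rd+a b∣qd+a)

quotRes*b≡a+negQuotRes*d : ∀ {a b d r s} → Coprime b d → ¬ (a ∈⟨ b , d ⟩) →
  IsNegQuotRes a d b r → IsQuotRes a b d s → s * b ≡ a + r * d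
quotRes*b≡a+negQuotRes*d {a} {b} {d} {r} {s} cop a∉⟨b,d⟩ (r<b , b∣rd+a) (s<d , d∣sb-a)
  with ℤ∣[+m-+n]⇒≡+* d∣sb-a
... | inj₂ (q , a≡sb+qd) = ⊥-elim (a∉⟨b,d⟩ (s , q , sym a≡sb+qd))
... | inj₁ (q , sb≡a+qd) = subst (λ x → s * b ≡ a + x * d) q≡r sb≡a+qd
  where
  q<b : q < b
  q<b = *-cancelʳ-< d q b (begin-strict
    q * d      ≤⟨ m≤n+m (q * d) a ⟩
    a + q * d  ≡⟨ sb≡a+qd ⟨
    s * b      <⟨ *-monoˡ-< b {{>-nonZero (≤-<-trans z≤n r<b)}} s<d ⟩
    d * b      ≡⟨ *-comm d b ⟩
    b * d      ∎)
    where open ≤-Reasoning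
  q≡r : q ≡ r
  q≡r = coprime-residue-unique cop q<b r<b
          (subst (b ∣_) (trans sb≡a+qd (+-comm a (q * d))) (n∣m*n s)) b∣rd+a

div≡/ : ∀ m n .{{_ : NonZero n}} → m div n ≡ m / n
div≡/ m (suc _) = refl

*<+⇒≤cdiv : ∀ {m R n} .{{_ : NonZero n}} → m * n < n + R → m ≤ R cdiv n
*<+⇒≤cdiv {m} {R} {n@(suc k)} m*n<n+R = begin
  m                  ≡⟨ m*n/n≡m m n ⟨
  m * n / n          ≤⟨ /-monoˡ-≤ n (subst (m * n ≤_) (+-comm k R) (s≤s⁻¹ m*n<n+R)) ⟩
  (R + k) / n        ∎
  where open ≤-Reasoning

module Candidate {a b d r s : ℕ} .{{_ : NonZero s}} (s*b≡a+r*d : s * b ≡ a + r * d) where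

  quot rem candidate : ℕ → ℕ
  quot α = α * d / s
  rem α = α * d % s
  candidate α = α * b ∸ r * quot α

  s*α*b≡ : ∀ α → s * (α * b) ≡ s * (r * quot α) + (α * a + r * rem α)
  s*α*b≡ α = expand (rem α) (quot α) (m≡m%n+[m/n]*n (α * d) s)
    where
    expand : ∀ ρ q → α * d ≡ ρ + q * s → s * (α * b) ≡ s * (r * q) + (α * a + r * ρ)
    expand ρ q α*d≡ρ+q*s = begin
      s * (α * b)                    ≡⟨ solve (s ∷ α ∷ b ∷ []) ⟩
      α * (s * b)                    ≡⟨ cong (α *_) s*b≡a+r*d ⟩
      α * (a + r * d)                ≡⟨ solve (α ∷ a ∷ r ∷ d ∷ []) ⟩
      α * a + r * (α * d)            ≡⟨ cong (λ z → α * a + r * z) α*d≡ρ+q*s ⟩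
      α * a + r * (ρ + q * s)        ≡⟨ solve (α ∷ a ∷ r ∷ ρ ∷ q ∷ s ∷ []) ⟩
      s * (r * q) + (α * a + r * ρ)  ∎
      where open ≡-Reasoning

  r*quot≤α*b : ∀ α → r * quot α ≤ α * b
  r*quot≤α*b α = *-cancelˡ-≤ s (subst (s * (r * quot α) ≤_) (sym (s*α*b≡ α)) (m≤m+n _ _))

  s*candidate≡ : ∀ α → s * candidate α ≡ α * a + r * rem α
  s*candidate≡ α = begin
    s * (α * b ∸ r * quot α)                                   ≡⟨ *-distribˡ-∸ s (α * b) (r * quot α) ⟩
    s * (α * b) ∸ s * (r * quot α)                             ≡⟨ cong (_∸ s * (r * quot α)) (s*α*b≡ α) ⟩
    s * (r * quot α) + (α * a + r * rem α) ∸ s * (r * quot α)  ≡⟨ m+n∸m≡n (s * (r * quot α)) _ ⟩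
    α * a + r * rem α                                          ∎
    where open ≡-Reasoning

  candidate*d≡ : ∀ α → candidate α * d ≡ quot α * a + rem α * b
  candidate*d≡ α = +-cancelʳ-≡ (r * quot α * d) _ _ (begin
    candidate α * d + r * quot α * d  ≡⟨ *-distribʳ-+ d (candidate α) (r * quot α) ⟨
    (candidate α + r * quot α) * d    ≡⟨ cong (_* d) (m∸n+n≡m (r*quot≤α*b α)) ⟩
    α * b * d                         ≡⟨ expand (rem α) (quot α) (m≡m%n+[m/n]*n (α * d) s) ⟩
    quot α * a + rem α * b + r * quot α * d ∎)
    where
    open ≡-Reasoning
    expand : ∀ ρ q → α * d ≡ ρ + q * s → α * b * d ≡ q * a + ρ * b + r * q * d
    expand ρ q α*d≡ρ+q*s = begin
      α * b * d                   ≡⟨ solve (α ∷ b ∷ d ∷ []) ⟩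
      (α * d) * b                 ≡⟨ cong (_* b) α*d≡ρ+q*s ⟩
      (ρ + q * s) * b             ≡⟨ solve (ρ ∷ q ∷ s ∷ b ∷ []) ⟩
      q * (s * b) + ρ * b         ≡⟨ cong (λ z → q * z + ρ * b) s*b≡a+r*d ⟩
      q * (a + r * d) + ρ * b     ≡⟨ solve (q ∷ a ∷ r ∷ d ∷ ρ ∷ b ∷ []) ⟩
      q * a + ρ * b + r * q * d   ∎

  term≡+candidate : ∀ α → term b d r s α ≡ + candidate α
  term≡+candidate α = begin
    + (α * b) ℤ.- + (r * ((α * d) div s)) ≡⟨ cong (λ z → + (α * b) ℤ.- + (r * z)) (div≡/ (α * d) s) ⟩
    + (α * b) ℤ.- + (r * quot α)         ≡⟨ ℤ.[+m]-[+n]≡m⊖n (α * b) (r * quot α) ⟩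
    α * b ℤ.⊖ r * quot α                 ≡⟨ ℤ.⊖-≥ (r*quot≤α*b α) ⟩
    + candidate α                        ∎
    where open ≡-Reasoning

  candidate>0 : ∀ {α} → 0 < a → 1 ≤ α → 0 < candidate α
  candidate>0 {α} 0<a 1≤α = >-nonZero⁻¹ (candidate α) {{m*n≢0⇒n≢0 s {{>-nonZero 0<s*candidate}}}}
    where
    0<s*candidate : 0 < s * candidate α
    0<s*candidate = <-≤-trans (*-mono-≤ 1≤α 0<a)
                      (subst (α * a ≤_) (sym (s*candidate≡ α)) (m≤m+n (α * a) _))

  module _ {c : ℕ} (0<a : 0 < a) (least : IsLeastPosMult a b d c) where

    c≤candidate : ∀ {α} → 1 ≤ α → c ≤ candidate α
    c≤candidate {α} 1≤α =
      proj₂ (proj₂ least) (candidate α) (candidate>0 0<a 1≤α) (quot α , rem α , sym (candidate*d≡ α))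

    candidate-attains : .{{_ : NonZero b}} → Coprime b d → (c * d) ∈⟨ a , b ⟩ →
      ∃ λ α → 1 ≤ α × candidate α ≡ c
    candidate-attains cop (x , y , xa+yb≡cd) = α , 1≤α , ≤-antisym candidate≤c (c≤candidate 1≤α)
      where
      open ≤-Reasoning
      d*[c+x*r]≡ : d * (c + x * r) ≡ (x * s + y) * b
      d*[c+x*r]≡ = begin-equality
        d * (c + x * r)              ≡⟨ solve (d ∷ c ∷ x ∷ r ∷ []) ⟩
        c * d + x * (r * d)          ≡⟨ cong (_+ x * (r * d)) xa+yb≡cd ⟨
        x * a + y * b + x * (r * d)  ≡⟨ solve (x ∷ a ∷ y ∷ b ∷ r ∷ d ∷ []) ⟩
        x * (a + r * d) + y * b      ≡⟨ cong (λ z → x * z + y * b) s*b≡a+r*d ⟨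
        x * (s * b) + y * b          ≡⟨ solve (x ∷ s ∷ b ∷ y ∷ []) ⟩
        (x * s + y) * b              ∎
      b∣c+x*r : b ∣ c + x * r
      b∣c+x*r = coprime-divisor cop (divides (x * s + y) d*[c+x*r]≡)
      α : ℕ
      α = _∣_.quotient b∣c+x*r
      c+x*r≡α*b : c + x * r ≡ α * b
      c+x*r≡α*b = _∣_.equality b∣c+x*r
      α*d≡x*s+y : α * d ≡ x * s + y
      α*d≡x*s+y = *-cancelʳ-≡ (α * d) (x * s + y) b (begin-equality
        α * d * b        ≡⟨ *-assoc α d b ⟩
        α * (d * b)      ≡⟨ cong (α *_) (*-comm d b) ⟩
        α * (b * d)      ≡⟨ *-assoc α b d ⟨
        α * b * d        ≡⟨ cong (_* d) c+x*r≡α*b ⟨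
        (c + x * r) * d  ≡⟨ *-comm (c + x * r) d ⟩
        d * (c + x * r)  ≡⟨ d*[c+x*r]≡ ⟩
        (x * s + y) * b  ∎)
      1≤α : 1 ≤ α
      1≤α = >-nonZero⁻¹ α {{m*n≢0⇒m≢0 α {{>-nonZero (subst (0 <_) c+x*r≡α*b
              (<-≤-trans (proj₁ least) (m≤m+n c (x * r))))}}}}
      x≤quot : x ≤ quot α
      x≤quot = begin
        x                ≡⟨ m*n/n≡m x s ⟨
        x * s / s        ≤⟨ /-monoˡ-≤ s (m≤m+n (x * s) y) ⟩
        (x * s + y) / s  ≡⟨ /-congˡ α*d≡x*s+y ⟨
        α * d / s        ∎
      candidate≤c : candidate α ≤ c
      candidate≤c = begin
        α * b ∸ r * quot α  ≤⟨ ∸-monoʳ-≤ (α * b) (*-monoʳ-≤ r x≤quot) ⟩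
        α * b ∸ r * x       ≡⟨ cong₂ _∸_ c+x*r≡α*b (*-comm x r) ⟨
        c + x * r ∸ x * r   ≡⟨ m+n∸n≡m c (x * r) ⟩
        c                   ∎

    attaining-index-bound : .{{_ : NonZero r}} → ∀ {α} → candidate α ≡ c → α * a < a + r * s
    attaining-index-bound {α} candidate≡c = begin-strict
      α * a                  ≤⟨ m≤m+n (α * a) (r * rem α) ⟩
      α * a + r * rem α      ≡⟨ s*candidate≡ α ⟨
      s * candidate α        ≡⟨ cong (s *_) candidate≡c ⟩
      s * c                  ≤⟨ *-monoʳ-≤ s (c≤candidate ≤-refl) ⟩
      s * candidate 1        ≡⟨ s*candidate≡ 1 ⟩
      1 * a + r * rem 1      <⟨ +-monoʳ-< (1 * a) (*-monoʳ-< r (m%n<n (1 * d) s)) ⟩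
      1 * a + r * s          ≡⟨ cong (_+ r * s) (*-identityˡ a) ⟩
      a + r * s              ∎
      where open ≤-Reasoning

    term-isMinOver : .{{_ : NonZero b}} .{{_ : NonZero r}} → Coprime b d →
      IsMinOver ((r * s) cdiv a) (term b d r s) (+ c)
    term-isMinOver cop = attained (candidate-attains cop (proj₁ (proj₂ least))) , bounded
      where
      attained : (∃ λ α → 1 ≤ α × candidate α ≡ c) →
        ∃₂ λ α (_ : 1 ≤ α × α ≤ (r * s) cdiv a) → term b d r s α ≡ + c
      attained (α , 1≤α , candidate≡c) =
        α , (1≤α , *<+⇒≤cdiv {{>-nonZero 0<a}} (attaining-index-bound {α} candidate≡c)) ,
        trans (term≡+candidate α) (cong +_ candidate≡c)
      bounded : ∀ α → 1 ≤ α → α ≤ (r * s) cdiv a → + c ℤ.≤ term b d r s α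
      bounded α 1≤α _ = subst (+ c ℤ.≤_) (sym (term≡+candidate α)) (ℤ.+≤+ (c≤candidate 1≤α))

leastMultiple-isMinOver : ∀ {a b d c r s} → 0 < a → Coprime b d → ¬ (a ∈⟨ b , d ⟩) →
  IsLeastPosMult a b d c → IsNegQuotRes a d b r → IsQuotRes a b d s →
  IsMinOver ((r * s) cdiv a) (term b d r s) (+ c)
leastMultiple-isMinOver {a} {b} {d} {r = r} {s} 0<a cop a∉⟨b,d⟩ least negRes@(r<b , _) res =
  term-isMinOver 0<a least cop
  where
  s*b≡a+r*d : s * b ≡ a + r * d
  s*b≡a+r*d = quotRes*b≡a+negQuotRes*d cop a∉⟨b,d⟩ negRes res
  instance
    b≢0 : NonZero b
    b≢0 = >-nonZero (≤-<-trans z≤n r<b)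
    s≢0 : NonZero s
    s≢0 = ≢-nonZero λ { refl → <⇒≢ 0<a (sym (m+n≡0⇒m≡0 a (sym s*b≡a+r*d))) }
    r≢0 : NonZero r
    r≢0 = ≢-nonZero λ { refl →
      a∉⟨b,d⟩ (s , 0 , trans (+-identityʳ (s * b)) (trans s*b≡a+r*d (+-identityʳ a))) }
  open Candidate {a} {b} {d} {r} {s} s*b≡a+r*d

theorem2p3 : (n : Fin 3 → ℕ) → (∀ i → 0 < n i) → PairwiseCoprime n → MinimalGenerators n →
    ∀ i j k → i ≢ j → j ≢ k → i ≢ k →
    ∀ (c r s : ℕ) → IsLeastPosMult (n i) (n j) (n k) c →
    IsNegQuotRes (n i) (n k) (n j) r → IsQuotRes (n i) (n j) (n k) s →
    IsMinOver ((r * s) cdiv (n i)) (term (n j) (n k) r s) (+ c)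
theorem2p3 n pos coprime minimal i j k i≢j j≢k i≢k c r s least negRes res =
  leastMultiple-isMinOver (pos i) (coprime j k j≢k)
    (minimal j k i j≢k (i≢k ∘ sym) (i≢j ∘ sym)) least negRes res
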